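{- Let $M_1,M_2$ be matroids on ground sets $E_1,E_2$ with $E_1\cap E_2=T$, $M_1|T=M_2|T$, and $T$ a modular flat of both $M_1$ and $M_2$. A subset $F\subseteq E_1\cup E_2$ is a corank-2 flat of $P_T(M_1,M_2)$ if and only if one of the following holds: (1) $T\subseteq F$ and there is $i\in\{1,2\}$ with $E_i\subseteq F$ and $F\cap E_{3-i}$ a corank-2 flat of $M_{3-i}$; (2) $T\subseteq F$ and $F\cap E_i$ is a hyperplane of $M_i$ for $i=1,2$; (3) $r_{M_1}(F\cap T)=r_{M_1}(T)-1$ and there is $i\in\{1,2\}$ such that $F\cap E_i$ is a hyperplane of $M_i$ and $F\cap E_{3-i}$ is a corank-2 flat of $M_{3-i}$; (4) $r_{M_1}(F\cap T)=r_{M_1}(T)-2$ and $F\cap E_i$ is a corank-2 flat of $M_i$ for $i=1,2$.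
   Context: A flat $T$ of a matroid $N$ with rank function $r$ is modular if $r(T)+r(F)=r(T\cap F)+r(T\cup F)$ for every flat $F$ of $N$. If $M_1|T=M_2|T$ and $T$ is a modular flat of at least one of $M_1,M_2$, the generalized parallel connection $P_T(M_1,M_2)$ is the matroid on $E_1\cup E_2$ whose flats are exactly the sets $F$ with $F\cap E_i$ a flat of $M_i$ for $i=1,2$. $r_{M_1}$ is the rank function of $M_1$. -}

module Defs where

open import Data.Nat using (ℕ; _≤_; _<_; _+_)
open import Data.Fin using (Fin)
open import Data.Fin.Subset using (Subset; _∈_; _∉_; _⊆_; _∩_; _∪_; ⁅_⁆; ∣_∣)
open import Data.Product using (_×_)
open import Relation.Binary.PropositionalEquality using (_≡_)

-- A (finite) matroid whose ground set E is a subset of a fixed finite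
-- universe Fin n, given by its rank function (axioms R1–R3 on subsets of E).
-- Values of r on sets not contained in E are irrelevant.
record Matroid (n : ℕ) : Set where
  field
    E      : Subset n
    r      : Subset n → ℕ
    r-card : ∀ X → X ⊆ E → r X ≤ ∣ X ∣
    r-mono : ∀ X Y → X ⊆ Y → Y ⊆ E → r X ≤ r Y
    r-sub  : ∀ X Y → X ⊆ E → Y ⊆ E → r (X ∪ Y) + r (X ∩ Y) ≤ r X + r Y

open Matroid public

Flat : ∀ {n} → Matroid n → Subset n → Set
Flat M F = F ⊆ E M × (∀ e → e ∈ E M → e ∉ F → r M F < r M (F ∪ ⁅ e ⁆))

Hyperplane : ∀ {n} → Matroid n → Subset n → Set
Hyperplane M F = Flat M F × (r M (E M) ≡ r M F + 1)

Corank2Flat : ∀ {n} → Matroid n → Subset n → Set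
Corank2Flat M F = Flat M F × (r M (E M) ≡ r M F + 2)

ModularFlat : ∀ {n} → Matroid n → Subset n → Set
ModularFlat M T =
  Flat M T × (∀ F → Flat M F → r M T + r M F ≡ r M (T ∩ F) + r M (T ∪ F))

SameRestriction : ∀ {n} → Matroid n → Matroid n → Subset n → Set
SameRestriction M₁ M₂ T = ∀ X → X ⊆ T → r M₁ X ≡ r M₂ X

IsGenParallelConnection : ∀ {n} → Matroid n → Matroid n → Subset n → Matroid n → Set
IsGenParallelConnection M₁ M₂ T P =
  (E P ≡ E M₁ ∪ E M₂) ×
  (∀ F → F ⊆ E M₁ ∪ E M₂ →
     (Flat P F → Flat M₁ (F ∩ E M₁) × Flat M₂ (F ∩ E M₂)) ×
     (Flat M₁ (F ∩ E M₁) × Flat M₂ (F ∩ E M₂) → Flat P F))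

-- Every flat F of P satisfies r_P(F) + r(F ∩ T) = r₁(F ∩ E₁) + r₂(F ∩ E₂), by induction on
-- r_P(F): if F ∩ T does not span F ∩ E₁, a hyperplane H of F ∩ E₁ containing F ∩ T, glued to
-- F ∩ E₂, is a flat of P covered by F, and the formula passes from it to F; if F ∩ T spans both
-- sides then F ⊆ T, where P and M₁ have the same flats. Let d, c₁, c₂ be the coranks of F ∩ T
-- in T and of F ∩ Eᵢ in Mᵢ. The formula for F and for E(P) shows that F has corank 2 exactly
-- when c₁ + c₂ = 2 + d, and modularity of T gives d ≤ cᵢ; the six solutions are the cases
-- of the statement.

module Submission where

open import Defs
open import Data.Nat using (ℕ; suc; _+_; _≤_; _<_; z≤n; s≤s; z<s; _≤?_; _<?_)
open import Data.Nat.Properties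
open import Data.Fin using (Fin)
open import Data.Fin.Properties using (any?)
open import Data.Fin.Subset using (Subset; _⊆_; _⊃_; _∩_; _∪_; _∈_; _∉_; ⁅_⁆; ⊥)
open import Data.Fin.Subset.Properties
  using (_∈?_; ∣⊥∣≡0; ∣⁅x⁆∣≡1; x∈⁅x⁆; x∈⁅y⁆⇒x≡y; p⊆p∪q; q⊆p∪q; x∈p∪q⁻; p∩q⊆p; p∩q⊆q; x∈p∩q⁺; ⊥⊆; ⊆-refl; ⊆-trans; ⊆-antisym; ∪-comm; ∩-comm; ∩-assoc)
open import Data.Fin.Subset.Induction using (⊃-wellFounded)
open import Induction.WellFounded using (Acc; acc)
open import Data.Product using (_×_; _,_; proj₁; proj₂; ∃; Σ-syntax)
import Data.Product as Product
open import Data.Sum using (_⊎_; inj₁; inj₂; [_,_]′)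
open import Relation.Nullary using (yes; no; contradiction)
open import Function.Bundles using (_⇔_; mk⇔; Equivalence)
open import Relation.Nullary.Decidable using (_×-dec_; ¬?; decidable-stable)
open import Relation.Binary.PropositionalEquality
open import Algebra.Properties.CommutativeSemigroup +-commutativeSemigroup using (xy∙z≈xz∙y; xy∙z≈x∙zy; interchange)

private variable
  n : ℕ
  e : Fin n
  A B F H K X Y Z : Subset n

<⇒+1≤ : ∀ {m n} → m < n → m + 1 ≤ n
<⇒+1≤ {m} {n} m<n = subst (_≤ n) (+-comm 1 m) m<n

≡+1⇒< : ∀ {m n} → n ≡ m + 1 → m < n
≡+1⇒< {m} n≡m+1 = subst (m <_) (sym n≡m+1) (m<m+n m z<s)

∪-least : X ⊆ Z → Y ⊆ Z → X ∪ Y ⊆ Z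
∪-least {X = X} {Y = Y} X⊆Z Y⊆Z x∈ = [ X⊆Z , Y⊆Z ]′ (x∈p∪q⁻ X Y x∈)

⁅⁆⊆ : e ∈ X → ⁅ e ⁆ ⊆ X
⁅⁆⊆ {e = e} {X = X} e∈X x∈ = subst (_∈ X) (sym (x∈⁅y⁆⇒x≡y e x∈)) e∈X

⊆-∩ : X ⊆ Y → X ⊆ Z → X ⊆ Y ∩ Z
⊆-∩ X⊆Y X⊆Z x∈ = x∈p∩q⁺ (X⊆Y x∈ , X⊆Z x∈)

∩-≡ˡ : X ⊆ Y → X ∩ Y ≡ X
∩-≡ˡ {X = X} {Y = Y} X⊆Y = ⊆-antisym (p∩q⊆p X Y) (⊆-∩ ⊆-refl X⊆Y)

∩-≡ʳ : Y ⊆ X → X ∩ Y ≡ Y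
∩-≡ʳ {Y = Y} {X = X} Y⊆X = trans (∩-comm X Y) (∩-≡ˡ Y⊆X)

∩-monoˡ-⊆ : X ⊆ Y → X ∩ Z ⊆ Y ∩ Z
∩-monoˡ-⊆ {X = X} {Z = Z} X⊆Y x∈ = x∈p∩q⁺ (X⊆Y (p∩q⊆p X Z x∈) , p∩q⊆q X Z x∈)

∩-monoʳ-⊆ : Y ⊆ Z → X ∩ Y ⊆ X ∩ Z
∩-monoʳ-⊆ {Y = Y} {X = X} Y⊆Z x∈ = x∈p∩q⁺ (p∩q⊆p X Y x∈ , Y⊆Z (p∩q⊆q X Y x∈))

∪-∩-≡ˡ : X ⊆ Z → Y ∩ Z ⊆ X → (X ∪ Y) ∩ Z ≡ X
∪-∩-≡ˡ {X = X} {Z = Z} {Y = Y} X⊆Z Y∩Z⊆X = ⊆-antisym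
  (λ x∈ → [ (λ x∈X → x∈X) , (λ x∈Y → Y∩Z⊆X (x∈p∩q⁺ (x∈Y , p∩q⊆q _ Z x∈))) ]′ (x∈p∪q⁻ X Y (p∩q⊆p _ Z x∈)))
  (⊆-∩ (p⊆p∪q Y) X⊆Z)

∪-∩-≡ʳ : Y ⊆ Z → X ∩ Z ⊆ Y → (X ∪ Y) ∩ Z ≡ Y
∪-∩-≡ʳ {Y = Y} {Z = Z} {X = X} Y⊆Z X∩Z⊆Y = trans (cong (_∩ Z) (∪-comm X Y)) (∪-∩-≡ˡ Y⊆Z X∩Z⊆Y)

⊆-or-∃∉ : (X Y : Subset n) → X ⊆ Y ⊎ ∃ λ e → e ∈ X × e ∉ Y
⊆-or-∃∉ X Y with any? (λ e → e ∈? X ×-dec ¬? (e ∈? Y))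
... | yes (e , e∈X , e∉Y) = inj₂ (e , e∈X , e∉Y)
... | no none = inj₁ λ {e} e∈X → decidable-stable (e ∈? Y) (λ e∉Y → none (e , e∈X , e∉Y))

module _ (M : Matroid n) where

  rank-⊥ : r M ⊥ ≡ 0
  rank-⊥ = n≤0⇒n≡0 (≤-trans (r-card M ⊥ ⊥⊆) (≤-reflexive (∣⊥∣≡0 n)))

  rank-∪-⁅⁆ : X ⊆ E M → e ∈ E M → r M (X ∪ ⁅ e ⁆) ≤ r M X + 1
  rank-∪-⁅⁆ {X} {e} X⊆E e∈E = begin
    r M (X ∪ ⁅ e ⁆)                      ≤⟨ m≤m+n _ _ ⟩
    r M (X ∪ ⁅ e ⁆) + r M (X ∩ ⁅ e ⁆)    ≤⟨ r-sub M X ⁅ e ⁆ X⊆E (⁅⁆⊆ e∈E) ⟩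
    r M X + r M ⁅ e ⁆                    ≤⟨ +-monoʳ-≤ (r M X) (≤-trans (r-card M ⁅ e ⁆ (⁅⁆⊆ e∈E)) (≤-reflexive (∣⁅x⁆∣≡1 e))) ⟩
    r M X + 1                            ∎
    where open ≤-Reasoning

  ∃∉-of-rank-< : A ⊆ E M → r M A < r M B → ∃ λ e → e ∈ B × e ∉ A
  ∃∉-of-rank-< {A} {B} A⊆E rA<rB with ⊆-or-∃∉ B A
  ... | inj₁ B⊆A = contradiction (r-mono M B A B⊆A A⊆E) (<⇒≱ rA<rB)
  ... | inj₂ witness = witness

  rank-<-∪-outside-flat : Flat M A → Z ⊆ A → e ∈ E M → e ∉ A → r M Z < r M (Z ∪ ⁅ e ⁆)
  rank-<-∪-outside-flat {A} {Z} {e} (A⊆E , A-closed) Z⊆A e∈E e∉A =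
    +-cancelˡ-< (r M A) _ _ (begin-strict
      r M A + r M Z                                        <⟨ +-monoˡ-< (r M Z) (A-closed e e∈E e∉A) ⟩
      r M (A ∪ ⁅ e ⁆) + r M Z                              ≤⟨ +-mono-≤ (r-mono M _ _ A∪e⊆A∪Ze A∪Ze⊆E)
                                                                       (r-mono M _ _ Z⊆A∩Ze (⊆-trans (p∩q⊆p A _) A⊆E)) ⟩
      r M (A ∪ (Z ∪ ⁅ e ⁆)) + r M (A ∩ (Z ∪ ⁅ e ⁆))        ≤⟨ r-sub M A (Z ∪ ⁅ e ⁆) A⊆E (∪-least (⊆-trans Z⊆A A⊆E) (⁅⁆⊆ e∈E)) ⟩
      r M A + r M (Z ∪ ⁅ e ⁆)                              ∎)
    where
      open ≤-Reasoning
      A∪e⊆A∪Ze : A ∪ ⁅ e ⁆ ⊆ A ∪ (Z ∪ ⁅ e ⁆)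
      A∪e⊆A∪Ze = ∪-least (p⊆p∪q _) (⊆-trans (q⊆p∪q Z _) (q⊆p∪q A _))
      A∪Ze⊆E : A ∪ (Z ∪ ⁅ e ⁆) ⊆ E M
      A∪Ze⊆E = ∪-least A⊆E (∪-least (⊆-trans Z⊆A A⊆E) (⁅⁆⊆ e∈E))
      Z⊆A∩Ze : Z ⊆ A ∩ (Z ∪ ⁅ e ⁆)
      Z⊆A∩Ze z∈ = x∈p∩q⁺ (Z⊆A z∈ , p⊆p∪q _ z∈)

  flat-rank-< : Flat M A → A ⊆ B → B ⊆ E M → e ∈ B → e ∉ A → r M A < r M B
  flat-rank-< {A} {B} {e} (A⊆E , A-closed) A⊆B B⊆E e∈B e∉A =
    <-≤-trans (A-closed e (B⊆E e∈B) e∉A) (r-mono M _ _ (∪-least A⊆B (⁅⁆⊆ e∈B)) B⊆E)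

  flat-⊇-of-rank-≤ : Flat M A → A ⊆ B → B ⊆ E M → r M B ≤ r M A → B ⊆ A
  flat-⊇-of-rank-≤ {A} {B} A-flat A⊆B B⊆E rB≤rA with ⊆-or-∃∉ B A
  ... | inj₁ B⊆A = B⊆A
  ... | inj₂ (e , e∈B , e∉A) = contradiction rB≤rA (<⇒≱ (flat-rank-< A-flat A⊆B B⊆E e∈B e∉A))

  flat-∩ : Flat M A → Flat M B → Flat M (A ∩ B)
  flat-∩ {A} {B} A-flat B-flat = ⊆-trans (p∩q⊆p A B) (proj₁ A-flat) , closed
    where
      closed : ∀ e → e ∈ E M → e ∉ A ∩ B → r M (A ∩ B) < r M ((A ∩ B) ∪ ⁅ e ⁆)
      closed e e∈E e∉A∩B with e ∈? A
      ... | no e∉A = rank-<-∪-outside-flat A-flat (p∩q⊆p A B) e∈E e∉A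
      ... | yes e∈A = rank-<-∪-outside-flat B-flat (p∩q⊆q A B) e∈E (λ e∈B → e∉A∩B (x∈p∩q⁺ (e∈A , e∈B)))

  -- Grow A inside B one element at a time while the rank stays below r B; the
  -- ⊂-maximal set reached is the required flat.
  ∃-hyperplane-between : A ⊆ B → Flat M B → r M A < r M B →
    Σ[ H ∈ Subset n ] Flat M H × A ⊆ H × H ⊆ B × r M B ≡ r M H + 1
  ∃-hyperplane-between {A} {B} A⊆B B-flat = grow (⊃-wellFounded A) A⊆B
    where
      B⊆E = proj₁ B-flat
      grow : ∀ {Y} → Acc _⊃_ Y → Y ⊆ B → r M Y < r M B →
             Σ[ H ∈ Subset n ] Flat M H × Y ⊆ H × H ⊆ B × r M B ≡ r M H + 1
      grow {Y} (acc larger) Y⊆B rY<rB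
        with any? (λ e → e ∈? B ×-dec ¬? (e ∈? Y) ×-dec (r M (Y ∪ ⁅ e ⁆) <? r M B))
      ... | yes (e , e∈B , e∉Y , rYe<rB) =
        let H , H-flat , Ye⊆H , H⊆B , rB≡rH+1 =
              grow (larger (p⊆p∪q _ , e , q⊆p∪q Y _ (x∈⁅x⁆ e) , e∉Y)) (∪-least Y⊆B (⁅⁆⊆ e∈B)) rYe<rB
        in H , H-flat , ⊆-trans (p⊆p∪q _) Ye⊆H , H⊆B , rB≡rH+1
      ... | no saturated = Y , (Y⊆E , closed) , ⊆-refl , Y⊆B , rB≡rY+1
        where
          Y⊆E : Y ⊆ E M
          Y⊆E = ⊆-trans Y⊆B B⊆E
          rB≤rYe : ∀ {e} → e ∈ B → e ∉ Y → r M B ≤ r M (Y ∪ ⁅ e ⁆)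
          rB≤rYe e∈B e∉Y = ≮⇒≥ (λ lt → saturated (_ , e∈B , e∉Y , lt))
          closed : ∀ e → e ∈ E M → e ∉ Y → r M Y < r M (Y ∪ ⁅ e ⁆)
          closed e e∈E e∉Y with e ∈? B
          ... | yes e∈B = <-≤-trans rY<rB (rB≤rYe e∈B e∉Y)
          ... | no e∉B = rank-<-∪-outside-flat B-flat Y⊆B e∈E e∉B
          rB≡rY+1 : r M B ≡ r M Y + 1
          rB≡rY+1 with ∃∉-of-rank-< Y⊆E rY<rB
          ... | e , e∈B , e∉Y = ≤-antisym (≤-trans (rB≤rYe e∈B e∉Y) (rank-∪-⁅⁆ Y⊆E (B⊆E e∈B)))
                                          (<⇒+1≤ rY<rB)

  flat-between-corank-one : Flat M H → Flat M K → H ⊆ K → K ⊆ F → F ⊆ E M →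
                            r M F ≡ r M H + 1 → K ⊆ H ⊎ F ⊆ K
  flat-between-corank-one {H} {K} {F} H-flat K-flat H⊆K K⊆F F⊆E rF≡rH+1
    with r M K ≤? r M H
  ... | yes rK≤rH = inj₁ (flat-⊇-of-rank-≤ H-flat H⊆K (proj₁ K-flat) rK≤rH)
  ... | no rK≰rH = inj₂ (flat-⊇-of-rank-≤ K-flat K⊆F F⊆E
                          (subst (_≤ r M K) (sym rF≡rH+1) (<⇒+1≤ (≰⇒> rK≰rH))))

  rank-suc-of-covering : ∀ {G} → Flat M G → Flat M F → G ⊆ F → r M G < r M F →
    (∀ K → Flat M K → G ⊆ K → K ⊆ F → K ⊆ G ⊎ F ⊆ K) → r M F ≡ r M G + 1
  rank-suc-of-covering {F} {G} G-flat F-flat G⊆F rG<rF covered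
    with ∃-hyperplane-between G⊆F F-flat rG<rF
  ... | H , H-flat , G⊆H , H⊆F , rF≡rH+1 with covered H H-flat G⊆H H⊆F
  ...   | inj₁ H⊆G = trans rF≡rH+1 (cong (_+ 1) (≤-antisym (r-mono M H G H⊆G (proj₁ G-flat))
                                                         (r-mono M G H G⊆H (proj₁ H-flat))))
  ...   | inj₂ F⊆H = contradiction (r-mono M F H F⊆H (proj₁ H-flat))
                       (<⇒≱ (≡+1⇒< rF≡rH+1))

-- Rank is the height in the lattice of flats.
rank-≤-of-flats-below : (M N : Matroid n) → Flat M X →
  (∀ {Y} → Y ⊆ X → Flat M Y → Flat N Y) → r M X ≤ r N X
rank-≤-of-flats-below M N X-flat M⇒N = go _ X-flat ≤-refl M⇒N
  where
    go : ∀ k {X} → Flat M X → r M X < k → (∀ {Y} → Y ⊆ X → Flat M Y → Flat N Y) → r M X ≤ r N X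
    go (suc k) {X} X-flat rX<1+k M⇒N with 0 <? r M X
    ... | no rX≯0 = subst (_≤ r N X) (sym (n≤0⇒n≡0 (≮⇒≥ rX≯0))) z≤n
    ... | yes rX>0
      with ∃-hyperplane-between M ⊥⊆ X-flat (subst (_< r M X) (sym (rank-⊥ M)) rX>0)
    ...   | H , H-flat , _ , H⊆X , rX≡rH+1 with ∃∉-of-rank-< M (proj₁ H-flat) (≡+1⇒< rX≡rH+1)
    ...     | e , e∈X , e∉H = begin
      r M X       ≡⟨ rX≡rH+1 ⟩
      r M H + 1   ≤⟨ +-monoˡ-≤ 1 (go k H-flat (<-≤-trans (≡+1⇒< rX≡rH+1) (≤-pred rX<1+k))
                                     (λ Y⊆H → M⇒N (⊆-trans Y⊆H H⊆X))) ⟩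
      r N H + 1   ≤⟨ <⇒+1≤ (flat-rank-< N (M⇒N H⊆X H-flat) H⊆X (proj₁ (M⇒N ⊆-refl X-flat)) e∈X e∉H) ⟩
      r N X       ∎
      where open ≤-Reasoning

ground-flat : (M : Matroid n) → Flat M (E M)
ground-flat M = ⊆-refl , λ e e∈E e∉E → contradiction e∈E e∉E

corank-0-of-⊇ : (M : Matroid n) → E M ⊆ F → Flat M (F ∩ E M) × r M (E M) ≡ r M (F ∩ E M) + 0
corank-0-of-⊇ M E⊆F rewrite ∩-≡ʳ E⊆F = ground-flat M , sym (+-identityʳ _)

⊇-of-corank-0 : (M : Matroid n) → Flat M (F ∩ E M) → r M (E M) ≡ r M (F ∩ E M) + 0 → E M ⊆ F
⊇-of-corank-0 {F = F} M F∩E-flat rE≡ x∈ =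
  p∩q⊆p F _ (flat-⊇-of-rank-≤ M F∩E-flat (p∩q⊆q F _) ⊆-refl (≤-reflexive (trans rE≡ (+-identityʳ _))) x∈)

record GenParallelConnection (M₁ M₂ : Matroid n) (T : Subset n) (P : Matroid n) : Set where
  field
    E₁∩E₂≡T    : E M₁ ∩ E M₂ ≡ T
    same-rank  : SameRestriction M₁ M₂ T
    T-flat₁    : Flat M₁ T
    T-flat₂    : Flat M₂ T
    connection : IsGenParallelConnection M₁ M₂ T P

private variable
  M₁ M₂ P : Matroid n
  T : Subset n

swap : GenParallelConnection M₁ M₂ T P → GenParallelConnection M₂ M₁ T P
swap {M₁ = M₁} {M₂ = M₂} C = record
  { E₁∩E₂≡T    = trans (∩-comm (E M₂) (E M₁)) E₁∩E₂≡T
  ; same-rank  = λ X X⊆T → sym (same-rank X X⊆T)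
  ; T-flat₁    = T-flat₂
  ; T-flat₂    = T-flat₁
  ; connection = trans E≡ (∪-comm (E M₁) (E M₂)) , λ F F⊆E →
      let to , from = flats F (subst (F ⊆_) (∪-comm (E M₂) (E M₁)) F⊆E)
      in (λ F-flat → Product.swap (to F-flat)) , (λ F-flats → from (Product.swap F-flats))
  }
  where
    open GenParallelConnection C
    E≡ = proj₁ connection
    flats = proj₂ connection

RankFormula : Matroid n → Matroid n → Subset n → Matroid n → Subset n → Set
RankFormula M₁ M₂ T P F = r P F + r M₁ (F ∩ T) ≡ r M₁ (F ∩ E M₁) + r M₂ (F ∩ E M₂)

RankFormula-swap : GenParallelConnection M₁ M₂ T P → ∀ F → RankFormula M₂ M₁ T P F → RankFormula M₁ M₂ T P F
RankFormula-swap {M₁ = M₁} {M₂ = M₂} {T = T} {P = P} C F formula = begin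
  r P F + r M₁ (F ∩ T)                     ≡⟨ cong (r P F +_) (same-rank (F ∩ T) (p∩q⊆q F T)) ⟩
  r P F + r M₂ (F ∩ T)                     ≡⟨ formula ⟩
  r M₂ (F ∩ E M₂) + r M₁ (F ∩ E M₁)        ≡⟨ +-comm (r M₂ (F ∩ E M₂)) _ ⟩
  r M₁ (F ∩ E M₁) + r M₂ (F ∩ E M₂)        ∎
  where
    open ≡-Reasoning
    open GenParallelConnection C

module Connection {n} {M₁ M₂ : Matroid n} {T : Subset n} {P : Matroid n}
                  (C : GenParallelConnection M₁ M₂ T P) where
  open GenParallelConnection C

  T⊆E₁ : T ⊆ E M₁
  T⊆E₁ x∈T = p∩q⊆p (E M₁) (E M₂) (subst (_ ∈_) (sym E₁∩E₂≡T) x∈T)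

  T⊆E₂ : T ⊆ E M₂
  T⊆E₂ x∈T = p∩q⊆q (E M₁) (E M₂) (subst (_ ∈_) (sym E₁∩E₂≡T) x∈T)

  ∈T : e ∈ E M₁ → e ∈ E M₂ → e ∈ T
  ∈T e∈E₁ e∈E₂ = subst (_ ∈_) E₁∩E₂≡T (x∈p∩q⁺ (e∈E₁ , e∈E₂))

  ⊆EP : X ⊆ E M₁ ∪ E M₂ → X ⊆ E P
  ⊆EP X⊆E x∈ = subst (_ ∈_) (sym (proj₁ connection)) (X⊆E x∈)

  E₁⊆EP : E M₁ ⊆ E P
  E₁⊆EP = ⊆EP (p⊆p∪q (E M₂))

  E₂⊆EP : E M₂ ⊆ E P
  E₂⊆EP = ⊆EP (q⊆p∪q (E M₁) (E M₂))

  T⊆EP : T ⊆ E P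
  T⊆EP = ⊆-trans T⊆E₁ E₁⊆EP

  EP⊆ : X ⊆ E P → X ⊆ E M₁ ∪ E M₂
  EP⊆ X⊆EP x∈ = subst (_ ∈_) (proj₁ connection) (X⊆EP x∈)

  T∩X∩E₁≡X∩T : T ∩ (X ∩ E M₁) ≡ X ∩ T
  T∩X∩E₁≡X∩T {X} = ⊆-antisym
    (⊆-∩ (⊆-trans (p∩q⊆q T _) (p∩q⊆p X _)) (p∩q⊆p T _))
    (⊆-∩ (p∩q⊆q X T) (∩-monoʳ-⊆ T⊆E₁))

  ⊆-of-parts : X ⊆ E P → X ∩ E M₁ ⊆ Y → X ∩ E M₂ ⊆ Y → X ⊆ Y
  ⊆-of-parts {X} X⊆EP X₁⊆Y X₂⊆Y x∈X =
    [ (λ x∈E₁ → X₁⊆Y (x∈p∩q⁺ (x∈X , x∈E₁))) , (λ x∈E₂ → X₂⊆Y (x∈p∩q⁺ (x∈X , x∈E₂))) ]′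
      (x∈p∪q⁻ (E M₁) (E M₂) (EP⊆ X⊆EP x∈X))

  flats-of-flat : Flat P F → Flat M₁ (F ∩ E M₁) × Flat M₂ (F ∩ E M₂)
  flats-of-flat {F} F-flat =
    proj₁ (proj₂ connection F (EP⊆ (proj₁ F-flat))) F-flat

  flat-of-flats : F ⊆ E P → Flat M₁ (F ∩ E M₁) → Flat M₂ (F ∩ E M₂) → Flat P F
  flat-of-flats {F} F⊆EP F₁-flat F₂-flat =
    proj₂ (proj₂ connection F (EP⊆ F⊆EP)) (F₁-flat , F₂-flat)

  flat₂-of-flat₁-⊆T : X ⊆ T → Flat M₁ X → Flat M₂ X
  flat₂-of-flat₁-⊆T {X} X⊆T (_ , X-closed₁) = (⊆-trans X⊆T T⊆E₂) , closed
    where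
      closed : ∀ e → e ∈ E M₂ → e ∉ X → r M₂ X < r M₂ (X ∪ ⁅ e ⁆)
      closed e e∈E₂ e∉X with e ∈? T
      ... | yes e∈T = subst₂ _<_ (same-rank X X⊆T) (same-rank (X ∪ ⁅ e ⁆) (∪-least X⊆T (⁅⁆⊆ e∈T)))
                             (X-closed₁ e (T⊆E₁ e∈T) e∉X)
      ... | no e∉T = rank-<-∪-outside-flat M₂ T-flat₂ X⊆T e∈E₂ e∉T

  flat-of-flat₁-⊆T : X ⊆ T → Flat M₁ X → Flat P X
  flat-of-flat₁-⊆T {X} X⊆T X-flat₁ =
    flat-of-flats (⊆-trans X⊆T T⊆EP)
      (subst (Flat M₁) (sym (∩-≡ˡ (⊆-trans X⊆T T⊆E₁))) X-flat₁)
      (subst (Flat M₂) (sym (∩-≡ˡ (⊆-trans X⊆T T⊆E₂))) (flat₂-of-flat₁-⊆T X⊆T X-flat₁))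

  ∩T-flat₁ : Flat P F → Flat M₁ (F ∩ T)
  ∩T-flat₁ {F} F-flat = subst (Flat M₁) F∩E₁∩T≡F∩T (flat-∩ M₁ (proj₁ (flats-of-flat F-flat)) T-flat₁)
    where
      F∩E₁∩T≡F∩T : (F ∩ E M₁) ∩ T ≡ F ∩ T
      F∩E₁∩T≡F∩T = trans (∩-assoc F (E M₁) T) (cong (F ∩_) (trans (∩-comm (E M₁) T) (∩-≡ˡ T⊆E₁)))

  ∩E₁⊆T-of-rank-≤ : Flat P F → r M₁ (F ∩ E M₁) ≤ r M₁ (F ∩ T) → F ∩ E M₁ ⊆ T
  ∩E₁⊆T-of-rank-≤ {F} F-flat rF₁≤rFT x∈ =
    p∩q⊆q F T (flat-⊇-of-rank-≤ M₁ (∩T-flat₁ F-flat) (∩-monoʳ-⊆ T⊆E₁)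
                (proj₁ (proj₁ (flats-of-flat F-flat))) rF₁≤rFT x∈)

  -- Inside T the flats of P and of M₁ coincide, so their ranks agree.
  rank-formula-⊆T : Flat P F → F ⊆ T → RankFormula M₁ M₂ T P F
  rank-formula-⊆T {F} F-flat F⊆T
    rewrite ∩-≡ˡ F⊆T | ∩-≡ˡ {X = F} (⊆-trans F⊆T T⊆E₁) | ∩-≡ˡ {X = F} (⊆-trans F⊆T T⊆E₂) =
    cong₂ _+_ (≤-antisym (rank-≤-of-flats-below P M₁ F-flat flat₁) (rank-≤-of-flats-below M₁ P (flat₁ ⊆-refl F-flat) flat-P))
              (same-rank F F⊆T)
    where
      flat₁ : ∀ {Y} → Y ⊆ F → Flat P Y → Flat M₁ Y
      flat₁ Y⊆F Y-flat = subst (Flat M₁) (∩-≡ˡ (⊆-trans (⊆-trans Y⊆F F⊆T) T⊆E₁)) (proj₁ (flats-of-flat Y-flat))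
      flat-P : ∀ {Y} → Y ⊆ F → Flat M₁ Y → Flat P Y
      flat-P Y⊆F = flat-of-flat₁-⊆T (⊆-trans Y⊆F F⊆T)

  module Glued {F H} (F-flat : Flat P F) (H-flat : Flat M₁ H)
               (F∩T⊆H : F ∩ T ⊆ H) (H⊆F₁ : H ⊆ F ∩ E M₁) where

    G : Subset n
    G = H ∪ (F ∩ E M₂)

    H⊆F : H ⊆ F
    H⊆F = ⊆-trans H⊆F₁ (p∩q⊆p F _)

    G⊆F : G ⊆ F
    G⊆F = ∪-least H⊆F (p∩q⊆p F _)

    G∩E₁≡H : G ∩ E M₁ ≡ H
    G∩E₁≡H = ∪-∩-≡ˡ (proj₁ H-flat) λ x∈ →
      let x∈F₂ = p∩q⊆p _ (E M₁) x∈
      in F∩T⊆H (x∈p∩q⁺ (p∩q⊆p F _ x∈F₂ , ∈T (p∩q⊆q _ (E M₁) x∈) (p∩q⊆q F _ x∈F₂)))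

    G∩E₂≡F₂ : G ∩ E M₂ ≡ F ∩ E M₂
    G∩E₂≡F₂ = ∪-∩-≡ʳ (p∩q⊆q F _) (∩-monoˡ-⊆ H⊆F)

    G∩T≡F∩T : G ∩ T ≡ F ∩ T
    G∩T≡F∩T = ⊆-antisym (∩-monoˡ-⊆ G⊆F) (⊆-∩ (⊆-trans F∩T⊆H (p⊆p∪q _)) (p∩q⊆q F T))

    G-flat : Flat P G
    G-flat = flat-of-flats (⊆-trans G⊆F (proj₁ F-flat))
               (subst (Flat M₁) (sym G∩E₁≡H) H-flat)
               (subst (Flat M₂) (sym G∩E₂≡F₂) (proj₂ (flats-of-flat F-flat)))

    covered : r M₁ (F ∩ E M₁) ≡ r M₁ H + 1 →
              ∀ K → Flat P K → G ⊆ K → K ⊆ F → K ⊆ G ⊎ F ⊆ K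
    covered rF₁≡rH+1 K K-flat G⊆K K⊆F
      with flat-between-corank-one M₁ H-flat (proj₁ (flats-of-flat K-flat))
             (⊆-∩ (⊆-trans (p⊆p∪q _) G⊆K) (proj₁ H-flat))
             (∩-monoˡ-⊆ K⊆F)
             (p∩q⊆q F _) rF₁≡rH+1
    ... | inj₁ K₁⊆H = inj₁ (⊆-of-parts (proj₁ K-flat) (⊆-trans K₁⊆H (p⊆p∪q _))
                                       (⊆-trans (∩-monoˡ-⊆ K⊆F) (q⊆p∪q H _)))
    ... | inj₂ F₁⊆K₁ = inj₂ (⊆-of-parts (proj₁ F-flat) (⊆-trans F₁⊆K₁ (p∩q⊆p K _))
                                        (⊆-trans (q⊆p∪q H _) G⊆K))

  -- F covers the glued flat H ∪ (F ∩ E M₂) in P, and the formula passes from one to the other.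
  rank-formula-step : Flat P F → r M₁ (F ∩ T) < r M₁ (F ∩ E M₁) →
    (∀ {G} → Flat P G → r P G < r P F → RankFormula M₁ M₂ T P G) → RankFormula M₁ M₂ T P F
  rank-formula-step {F} F-flat rFT<rF₁ formula-below
    with ∃-hyperplane-between M₁ (∩-monoʳ-⊆ T⊆E₁) (proj₁ (flats-of-flat F-flat)) rFT<rF₁
  ... | H , H-flat , F∩T⊆H , H⊆F₁ , rF₁≡rH+1
    with ∃∉-of-rank-< M₁ (proj₁ H-flat) (≡+1⇒< rF₁≡rH+1)
  ... | e , e∈F₁ , e∉H = begin
    r P F + r M₁ (F ∩ T)                       ≡⟨ cong₂ _+_ rF≡rG+1 (cong (r M₁) (sym G∩T≡F∩T)) ⟩
    r P G + 1 + r M₁ (G ∩ T)                   ≡⟨ xy∙z≈xz∙y (r P G) 1 _ ⟩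
    r P G + r M₁ (G ∩ T) + 1                   ≡⟨ cong (_+ 1) (formula-below G-flat rG<rF) ⟩
    r M₁ (G ∩ E M₁) + r M₂ (G ∩ E M₂) + 1      ≡⟨ cong₂ (λ X Y → r M₁ X + r M₂ Y + 1) G∩E₁≡H G∩E₂≡F₂ ⟩
    r M₁ H + r M₂ (F ∩ E M₂) + 1               ≡⟨ xy∙z≈xz∙y (r M₁ H) _ 1 ⟩
    r M₁ H + 1 + r M₂ (F ∩ E M₂)               ≡⟨ cong (_+ r M₂ (F ∩ E M₂)) (sym rF₁≡rH+1) ⟩
    r M₁ (F ∩ E M₁) + r M₂ (F ∩ E M₂)          ∎
    where
      open ≡-Reasoning
      open Glued F-flat H-flat F∩T⊆H H⊆F₁
      e∉G : e ∉ G
      e∉G e∈G = e∉H (subst (e ∈_) G∩E₁≡H (x∈p∩q⁺ (e∈G , p∩q⊆q F _ e∈F₁)))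
      rG<rF : r P G < r P F
      rG<rF = flat-rank-< P G-flat G⊆F (proj₁ F-flat) (p∩q⊆p F _ e∈F₁) e∉G
      rF≡rG+1 : r P F ≡ r P G + 1
      rF≡rG+1 = rank-suc-of-covering P G-flat F-flat G⊆F rG<rF (covered rF₁≡rH+1)

rank-formula : GenParallelConnection M₁ M₂ T P → Flat P F → RankFormula M₁ M₂ T P F
rank-formula {M₁ = M₁} {M₂ = M₂} {T = T} {P = P} C F-flat = go _ F-flat (n<1+n _)
  where
    go : ∀ k {F} → Flat P F → r P F < k → RankFormula M₁ M₂ T P F
    go (suc k) {F} F-flat rF<1+k
      with r M₁ (F ∩ T) <? r M₁ (F ∩ E M₁) | r M₂ (F ∩ T) <? r M₂ (F ∩ E M₂)
    ... | yes rFT<rF₁ | _ = Connection.rank-formula-step C F-flat rFT<rF₁ below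
      where
        below : ∀ {G} → Flat P G → r P G < r P F → RankFormula M₁ M₂ T P G
        below G-flat rG<rF = go k G-flat (<-≤-trans rG<rF (≤-pred rF<1+k))
    ... | no _ | yes rFT<rF₂ =
      RankFormula-swap C F (Connection.rank-formula-step (swap C) F-flat rFT<rF₂ below)
      where
        below : ∀ {G} → Flat P G → r P G < r P F → RankFormula M₂ M₁ T P G
        below {G} G-flat rG<rF = RankFormula-swap (swap C) G (go k G-flat (<-≤-trans rG<rF (≤-pred rF<1+k)))
    ... | no rFT≮rF₁ | no rFT≮rF₂ =
      Connection.rank-formula-⊆T C F-flat
        (Connection.⊆-of-parts C (proj₁ F-flat)
          (Connection.∩E₁⊆T-of-rank-≤ C F-flat (≮⇒≥ rFT≮rF₁))
          (Connection.∩E₁⊆T-of-rank-≤ (swap C) F-flat (≮⇒≥ rFT≮rF₂)))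

corank-∩-≤-of-modular : (M : Matroid n) → ModularFlat M T → Flat M X → ∀ {d c} →
  r M T ≡ r M (T ∩ X) + d → r M (E M) ≡ r M X + c → d ≤ c
corank-∩-≤-of-modular {T = T} {X = X} M (T-flat , modular) X-flat {d} {c} rT≡ rE≡ =
  +-cancelˡ-≤ (r M (T ∩ X) + r M X) d c (begin
    r M (T ∩ X) + r M X + d        ≡⟨ xy∙z≈xz∙y (r M (T ∩ X)) (r M X) d ⟩
    r M (T ∩ X) + d + r M X        ≡⟨ cong (_+ r M X) (sym rT≡) ⟩
    r M T + r M X                  ≡⟨ modular X X-flat ⟩
    r M (T ∩ X) + r M (T ∪ X)      ≤⟨ +-monoʳ-≤ (r M (T ∩ X)) (r-mono M _ _ (∪-least (proj₁ T-flat) (proj₁ X-flat)) ⊆-refl) ⟩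
    r M (T ∩ X) + r M (E M)        ≡⟨ cong (r M (T ∩ X) +_) rE≡ ⟩
    r M (T ∩ X) + (r M X + c)      ≡⟨ sym (+-assoc (r M (T ∩ X)) (r M X) c) ⟩
    r M (T ∩ X) + r M X + c        ∎)
  where open ≤-Reasoning

corank-balance : ∀ {R p t tF e₁ x₁ e₂ x₂ d c₁ c₂} →
  R + t ≡ e₁ + e₂ → p + tF ≡ x₁ + x₂ → t ≡ tF + d → e₁ ≡ x₁ + c₁ → e₂ ≡ x₂ + c₂ →
  R + d ≡ p + (c₁ + c₂)
corank-balance {R} {p} {tF = tF} {x₁ = x₁} {x₂ = x₂} {d} {c₁} {c₂} at-ground at-F refl refl refl =
  +-cancelʳ-≡ tF (R + d) (p + (c₁ + c₂)) (begin
    R + d + tF                ≡⟨ xy∙z≈x∙zy R d tF ⟩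
    R + (tF + d)              ≡⟨ at-ground ⟩
    x₁ + c₁ + (x₂ + c₂)       ≡⟨ interchange x₁ c₁ x₂ c₂ ⟩
    x₁ + x₂ + (c₁ + c₂)       ≡⟨ cong (_+ (c₁ + c₂)) (sym at-F) ⟩
    p + tF + (c₁ + c₂)        ≡⟨ xy∙z≈xz∙y p tF (c₁ + c₂) ⟩
    p + (c₁ + c₂) + tF        ∎)
  where open ≡-Reasoning

rank-gap⇔corank-sum : ∀ {R p d c} → R + d ≡ p + c → R ≡ p + 2 ⇔ c ≡ 2 + d
rank-gap⇔corank-sum {R} {p} {d} {c} balance = mk⇔
  (λ R≡p+2 → +-cancelˡ-≡ p c (2 + d) (trans (sym balance) (trans (cong (_+ d) R≡p+2) (+-assoc p 2 d))))
  (λ c≡2+d → +-cancelʳ-≡ d R (p + 2) (trans balance (trans (cong (p +_) c≡2+d) (sym (+-assoc p 2 d)))))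

-- Indexed by the coranks of F ∩ T in T, of F ∩ E₁ in M₁ and of F ∩ E₂ in M₂.
data CorankPattern : ℕ → ℕ → ℕ → Set where
  E₁-full     : CorankPattern 0 0 2
  E₂-full     : CorankPattern 0 2 0
  hyperplanes : CorankPattern 0 1 1
  hyperplane₁ : CorankPattern 1 1 2
  hyperplane₂ : CorankPattern 1 2 1
  corank-two  : CorankPattern 2 2 2

corank-pattern-sum : ∀ {d c₁ c₂} → CorankPattern d c₁ c₂ → c₁ + c₂ ≡ 2 + d
corank-pattern-sum E₁-full     = refl
corank-pattern-sum E₂-full     = refl
corank-pattern-sum hyperplanes = refl
corank-pattern-sum hyperplane₁ = refl
corank-pattern-sum hyperplane₂ = refl
corank-pattern-sum corank-two  = refl

corank-pattern : ∀ d c₁ c₂ → c₁ + c₂ ≡ 2 + d → d ≤ c₁ → d ≤ c₂ → CorankPattern d c₁ c₂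
corank-pattern 0 0 _ refl _ _ = E₁-full
corank-pattern 0 1 _ refl _ _ = hyperplanes
corank-pattern 0 2 _ refl _ _ = E₂-full
corank-pattern 0 (suc (suc (suc _))) _ () _ _
corank-pattern 1 1 _ refl _ _ = hyperplane₁
corank-pattern 1 2 _ refl _ _ = hyperplane₂
corank-pattern 1 3 _ refl _ ()
corank-pattern 1 (suc (suc (suc (suc _)))) _ () _ _
corank-pattern 2 1 _ _ (s≤s ()) _
corank-pattern 2 2 _ refl _ _ = corank-two
corank-pattern 2 3 _ refl _ (s≤s ())
corank-pattern 2 4 _ refl _ ()
corank-pattern 2 (suc (suc (suc (suc (suc _))))) _ () _ _
corank-pattern (suc (suc (suc d))) c₁ c₂ sum d≤c₁ d≤c₂ =
  contradiction (+-cancelʳ-≤ (3 + d) (3 + d) 2 (subst (3 + d + (3 + d) ≤_) sum (+-mono-≤ d≤c₁ d≤c₂)))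
                (λ { (s≤s (s≤s ())) })

CorankTwoCases : Matroid n → Matroid n → Subset n → Subset n → Set
CorankTwoCases M₁ M₂ T F =
  (T ⊆ F × ((E M₁ ⊆ F × Corank2Flat M₂ (F ∩ E M₂))
            ⊎ (E M₂ ⊆ F × Corank2Flat M₁ (F ∩ E M₁))))
  ⊎ (T ⊆ F × Hyperplane M₁ (F ∩ E M₁) × Hyperplane M₂ (F ∩ E M₂))
  ⊎ ((r M₁ T ≡ r M₁ (F ∩ T) + 1)
     × ((Hyperplane M₁ (F ∩ E M₁) × Corank2Flat M₂ (F ∩ E M₂))
       ⊎ (Hyperplane M₂ (F ∩ E M₂) × Corank2Flat M₁ (F ∩ E M₁))))
  ⊎ ((r M₁ T ≡ r M₁ (F ∩ T) + 2)
     × Corank2Flat M₁ (F ∩ E M₁) × Corank2Flat M₂ (F ∩ E M₂))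

module CorankTwo {n} {M₁ M₂ : Matroid n} {T : Subset n} {P : Matroid n}
                 (C : GenParallelConnection M₁ M₂ T P)
                 (T-modular₁ : ModularFlat M₁ T) (T-modular₂ : ModularFlat M₂ T) where
  open GenParallelConnection C
  open Connection C

  Coranks : ℕ → ℕ → ℕ → Subset n → Set
  Coranks d c₁ c₂ F = (r M₁ T ≡ r M₁ (F ∩ T) + d)
                    × (r M₁ (E M₁) ≡ r M₁ (F ∩ E M₁) + c₁)
                    × (r M₂ (E M₂) ≡ r M₂ (F ∩ E M₂) + c₂)

  ∃-coranks : ∀ F → ∃ λ d → ∃ λ c₁ → ∃ λ c₂ → Coranks d c₁ c₂ F
  ∃-coranks F =
    let d , rFT+d≡rT = m≤n⇒∃[o]m+o≡n (r-mono M₁ _ _ (p∩q⊆q F T) T⊆E₁)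
        c₁ , rF₁+c₁≡rE₁ = m≤n⇒∃[o]m+o≡n (r-mono M₁ _ _ (p∩q⊆q F _) ⊆-refl)
        c₂ , rF₂+c₂≡rE₂ = m≤n⇒∃[o]m+o≡n (r-mono M₂ _ _ (p∩q⊆q F _) ⊆-refl)
    in d , c₁ , c₂ , sym rFT+d≡rT , sym rF₁+c₁≡rE₁ , sym rF₂+c₂≡rE₂

  corank-two⇔ : ∀ {d c₁ c₂ F} → Flat P F → Coranks d c₁ c₂ F →
                r P (E P) ≡ r P F + 2 ⇔ c₁ + c₂ ≡ 2 + d
  corank-two⇔ {F = F} F-flat (rT≡ , rE₁≡ , rE₂≡) =
    rank-gap⇔corank-sum (corank-balance {p = r P F} {x₁ = r M₁ (F ∩ E M₁)} {x₂ = r M₂ (F ∩ E M₂)}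
                           ground-formula (rank-formula C F-flat) rT≡ rE₁≡ rE₂≡)
    where
      open ≡-Reasoning
      ground-formula : r P (E P) + r M₁ T ≡ r M₁ (E M₁) + r M₂ (E M₂)
      ground-formula = begin
        r P (E P) + r M₁ T                           ≡⟨ cong (λ X → r P (E P) + r M₁ X) (sym (∩-≡ʳ T⊆EP)) ⟩
        r P (E P) + r M₁ (E P ∩ T)                   ≡⟨ rank-formula C (ground-flat P) ⟩
        r M₁ (E P ∩ E M₁) + r M₂ (E P ∩ E M₂)        ≡⟨ cong₂ (λ X Y → r M₁ X + r M₂ Y) (∩-≡ʳ E₁⊆EP) (∩-≡ʳ E₂⊆EP) ⟩
        r M₁ (E M₁) + r M₂ (E M₂)                    ∎

  T-corank≤E₁-corank : ∀ {d c₁ c₂ F} → Flat P F → Coranks d c₁ c₂ F → d ≤ c₁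
  T-corank≤E₁-corank F-flat (rT≡ , rE₁≡ , _) =
    corank-∩-≤-of-modular M₁ T-modular₁ (proj₁ (flats-of-flat F-flat))
      (trans rT≡ (cong (λ X → r M₁ X + _) (sym T∩X∩E₁≡X∩T))) rE₁≡

  T-corank≤E₂-corank : ∀ {d c₁ c₂ F} → Flat P F → Coranks d c₁ c₂ F → d ≤ c₂
  T-corank≤E₂-corank {d} {F = F} F-flat (rT≡ , _ , rE₂≡) =
    corank-∩-≤-of-modular M₂ T-modular₂ (proj₂ (flats-of-flat F-flat)) r₂T≡ rE₂≡
    where
      open ≡-Reasoning
      r₂T≡ : r M₂ T ≡ r M₂ (T ∩ (F ∩ E M₂)) + d
      r₂T≡ = begin
        r M₂ T                         ≡⟨ sym (same-rank T ⊆-refl) ⟩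
        r M₁ T                         ≡⟨ rT≡ ⟩
        r M₁ (F ∩ T) + d               ≡⟨ cong (_+ d) (same-rank (F ∩ T) (p∩q⊆q F T)) ⟩
        r M₂ (F ∩ T) + d               ≡⟨ cong (λ X → r M₂ X + d) (sym (Connection.T∩X∩E₁≡X∩T (swap C))) ⟩
        r M₂ (T ∩ (F ∩ E M₂)) + d      ∎

  ⊆-of-T-corank-0 : ∀ {F} → Flat P F → r M₁ T ≡ r M₁ (F ∩ T) + 0 → T ⊆ F
  ⊆-of-T-corank-0 {F} F-flat rT≡ x∈ =
    p∩q⊆p F T (flat-⊇-of-rank-≤ M₁ (∩T-flat₁ F-flat) (p∩q⊆q F T) T⊆E₁
                 (≤-reflexive (trans rT≡ (+-identityʳ _))) x∈)

  T-corank-0 : ∀ {F} → T ⊆ F → r M₁ T ≡ r M₁ (F ∩ T) + 0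
  T-corank-0 T⊆F = trans (cong (r M₁) (sym (∩-≡ʳ T⊆F))) (sym (+-identityʳ _))

  cases-of-pattern : ∀ {d c₁ c₂ F} → Flat P F → Coranks d c₁ c₂ F → CorankPattern d c₁ c₂ →
                     CorankTwoCases M₁ M₂ T F
  cases-of-pattern F-flat (rT≡ , rE₁≡ , rE₂≡) shape with flats-of-flat F-flat
  ... | F₁-flat , F₂-flat with shape
  ...   | E₁-full     = inj₁ (⊆-of-T-corank-0 F-flat rT≡ , inj₁ (⊇-of-corank-0 M₁ F₁-flat rE₁≡ , F₂-flat , rE₂≡))
  ...   | E₂-full     = inj₁ (⊆-of-T-corank-0 F-flat rT≡ , inj₂ (⊇-of-corank-0 M₂ F₂-flat rE₂≡ , F₁-flat , rE₁≡))
  ...   | hyperplanes = inj₂ (inj₁ (⊆-of-T-corank-0 F-flat rT≡ , (F₁-flat , rE₁≡) , (F₂-flat , rE₂≡)))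
  ...   | hyperplane₁ = inj₂ (inj₂ (inj₁ (rT≡ , inj₁ ((F₁-flat , rE₁≡) , (F₂-flat , rE₂≡)))))
  ...   | hyperplane₂ = inj₂ (inj₂ (inj₁ (rT≡ , inj₂ ((F₂-flat , rE₂≡) , (F₁-flat , rE₁≡)))))
  ...   | corank-two  = inj₂ (inj₂ (inj₂ (rT≡ , (F₁-flat , rE₁≡) , (F₂-flat , rE₂≡))))

  cases-of-corank-two : ∀ {F} → Corank2Flat P F → CorankTwoCases M₁ M₂ T F
  cases-of-corank-two {F} (F-flat , rEP≡) with ∃-coranks F
  ... | d , c₁ , c₂ , coranks =
    cases-of-pattern F-flat coranks
      (corank-pattern d c₁ c₂ (Equivalence.to (corank-two⇔ F-flat coranks) rEP≡)
        (T-corank≤E₁-corank F-flat coranks) (T-corank≤E₂-corank F-flat coranks))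

  corank-two-of-pattern : ∀ {d c₁ c₂ F} → F ⊆ E M₁ ∪ E M₂ →
    Flat M₁ (F ∩ E M₁) → Flat M₂ (F ∩ E M₂) → Coranks d c₁ c₂ F → CorankPattern d c₁ c₂ →
    Corank2Flat P F
  corank-two-of-pattern F⊆E F₁-flat F₂-flat coranks shape =
    F-flat , Equivalence.from (corank-two⇔ F-flat coranks) (corank-pattern-sum shape)
    where F-flat = flat-of-flats (⊆EP F⊆E) F₁-flat F₂-flat

  corank-two-of-cases : ∀ {F} → F ⊆ E M₁ ∪ E M₂ → CorankTwoCases M₁ M₂ T F → Corank2Flat P F
  corank-two-of-cases F⊆E (inj₁ (T⊆F , inj₁ (E₁⊆F , F₂-flat , rE₂≡))) =
    let F₁-flat , rE₁≡ = corank-0-of-⊇ M₁ E₁⊆F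
    in corank-two-of-pattern F⊆E F₁-flat F₂-flat (T-corank-0 T⊆F , rE₁≡ , rE₂≡) E₁-full
  corank-two-of-cases F⊆E (inj₁ (T⊆F , inj₂ (E₂⊆F , F₁-flat , rE₁≡))) =
    let F₂-flat , rE₂≡ = corank-0-of-⊇ M₂ E₂⊆F
    in corank-two-of-pattern F⊆E F₁-flat F₂-flat (T-corank-0 T⊆F , rE₁≡ , rE₂≡) E₂-full
  corank-two-of-cases F⊆E (inj₂ (inj₁ (T⊆F , (F₁-flat , rE₁≡) , (F₂-flat , rE₂≡)))) =
    corank-two-of-pattern F⊆E F₁-flat F₂-flat (T-corank-0 T⊆F , rE₁≡ , rE₂≡) hyperplanes
  corank-two-of-cases F⊆E (inj₂ (inj₂ (inj₁ (rT≡ , inj₁ ((F₁-flat , rE₁≡) , (F₂-flat , rE₂≡)))))) =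
    corank-two-of-pattern F⊆E F₁-flat F₂-flat (rT≡ , rE₁≡ , rE₂≡) hyperplane₁
  corank-two-of-cases F⊆E (inj₂ (inj₂ (inj₁ (rT≡ , inj₂ ((F₂-flat , rE₂≡) , (F₁-flat , rE₁≡)))))) =
    corank-two-of-pattern F⊆E F₁-flat F₂-flat (rT≡ , rE₁≡ , rE₂≡) hyperplane₂
  corank-two-of-cases F⊆E (inj₂ (inj₂ (inj₂ (rT≡ , (F₁-flat , rE₁≡) , (F₂-flat , rE₂≡))))) =
    corank-two-of-pattern F⊆E F₁-flat F₂-flat (rT≡ , rE₁≡ , rE₂≡) corank-two

proposition2p7 :
  ∀ {n} (M₁ M₂ : Matroid n) (T : Subset n) (P : Matroid n) →
  E M₁ ∩ E M₂ ≡ T →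
  SameRestriction M₁ M₂ T →
  ModularFlat M₁ T →
  ModularFlat M₂ T →
  IsGenParallelConnection M₁ M₂ T P →
  ∀ (F : Subset n) → F ⊆ E M₁ ∪ E M₂ →
    (Corank2Flat P F →
      ((T ⊆ F × ((E M₁ ⊆ F × Corank2Flat M₂ (F ∩ E M₂))
                ⊎ (E M₂ ⊆ F × Corank2Flat M₁ (F ∩ E M₁))))
      ⊎ (T ⊆ F × Hyperplane M₁ (F ∩ E M₁) × Hyperplane M₂ (F ∩ E M₂))
      ⊎ ((r M₁ T ≡ r M₁ (F ∩ T) + 1)
         × ((Hyperplane M₁ (F ∩ E M₁) × Corank2Flat M₂ (F ∩ E M₂))
           ⊎ (Hyperplane M₂ (F ∩ E M₂) × Corank2Flat M₁ (F ∩ E M₁))))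
      ⊎ ((r M₁ T ≡ r M₁ (F ∩ T) + 2)
         × Corank2Flat M₁ (F ∩ E M₁) × Corank2Flat M₂ (F ∩ E M₂))))
    ×
    (((T ⊆ F × ((E M₁ ⊆ F × Corank2Flat M₂ (F ∩ E M₂))
                ⊎ (E M₂ ⊆ F × Corank2Flat M₁ (F ∩ E M₁))))
      ⊎ (T ⊆ F × Hyperplane M₁ (F ∩ E M₁) × Hyperplane M₂ (F ∩ E M₂))
      ⊎ ((r M₁ T ≡ r M₁ (F ∩ T) + 1)
         × ((Hyperplane M₁ (F ∩ E M₁) × Corank2Flat M₂ (F ∩ E M₂))
           ⊎ (Hyperplane M₂ (F ∩ E M₂) × Corank2Flat M₁ (F ∩ E M₁))))
      ⊎ ((r M₁ T ≡ r M₁ (F ∩ T) + 2)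
         × Corank2Flat M₁ (F ∩ E M₁) × Corank2Flat M₂ (F ∩ E M₂)))
     → Corank2Flat P F)
proposition2p7 M₁ M₂ T P E₁∩E₂≡T same T-modular₁ T-modular₂ connection F F⊆E =
  cases-of-corank-two , corank-two-of-cases F⊆E
  where
    C : GenParallelConnection M₁ M₂ T P
    C = record
      { E₁∩E₂≡T    = E₁∩E₂≡T
      ; same-rank  = same
      ; T-flat₁    = proj₁ T-modular₁
      ; T-flat₂    = proj₁ T-modular₂
      ; connection = connection
      }
    open CorankTwo C T-modular₁ T-modular₂
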